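{- Let $d\geq 3$. Let $\Delta$ be a strongly connected $(d-1)$-dimensional simplicial complex with a map $p:V(\Delta)\to\mathbb{R}^d$ such that for any two adjacent facets $F,F'$ of $\Delta$, the $d+1$ points $p(F\cup F')$ are affinely independent. Then $$\mathrm{Stress}^a_1(\Delta,p)=\sum_{G\in\Delta,\ \dim G=d-3}\mathrm{Stress}^a_1(\mathrm{st}(G),p).$$ In particular, $\mathrm{Stress}^a_1(\Delta,p)=\sum_{v\in V(\Delta)}\mathrm{Stress}^a_1(\mathrm{st}(v),p)$.
   Context: A pure $(d-1)$-dimensional complex has all facets of dimension $d-1$; two facets are adjacent if they share a $(d-2)$-face; the complex is strongly connected if any two facets are joined by a sequence of pairwise adjacent facets. Stresses: for $\Gamma$ on vertex set $V$ and $p:V\to\mathbb{R}^d$, let $\mathbb{R}[X]=\mathbb{R}[x_v:v\in V]$, $\theta_m=\sum_v p(v)_mx_v$ ($m=1,\dots,d$), $c=\sum_v x_v$, and $\partial_\ell=\sum_v\ell_v\partial/\partial x_v$ for $\ell=\sum_v\ell_vx_v$. A homogeneous degree-$k$ polynomial $\lambda$ is an affine $k$-stress on $(\Gamma,p)$ if every monomial with nonzero coefficient has support a face of $\Gamma$, $\partial_{\theta_m}\lambda=0$ for $m=1,\dots,d$, and $\partial_c\lambda=0$. $\mathrm{Stress}^a_k(\Gamma,p)$ is the space of these (for a subcomplex, $p$ restricted); thus $\mathrm{Stress}^a_1(\Gamma,p)$ consists of $\sum_va_vx_v$ with $(a_v)$ an affine dependence of the points $p(v)$ supported on vertices of $\Gamma$.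 The star is $\mathrm{st}(G)=\{\sigma\in\Delta:\sigma\cup G\in\Delta\}$. -}

module Defs where

open import Level using (0ℓ)
open import Data.Nat as ℕ using (ℕ; suc; _∸_)
open import Data.Fin using (Fin; zero; suc)
open import Data.Fin.Subset using (Subset; _∈_; _⊆_; _∪_; _∩_; ∣_∣; ⁅_⁆; ⊥)
open import Data.Bool using (Bool; T)
open import Data.List using (List; []; _∷_; foldr; map)
open import Data.List.Relation.Unary.All using (All)
open import Data.Product using (Σ; ∃; _×_; _,_; proj₁; proj₂)
open import Data.Sum using (_⊎_)
open import Relation.Nullary using (¬_; Dec)
open import Relation.Binary.PropositionalEquality using (_≡_)
open import Relation.Binary.Construct.Closure.ReflexiveTransitive using (Star)
open import Algebra.Bundles using (CommutativeRing)

-- The real numbers, axiomatised as a (Dedekind-)complete ordered field.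
-- Any model of this record is isomorphic to ℝ.  Decidability of the
-- order (trichotomy) is included as an axiom; it holds for the
-- classical reals.

record RealField : Set₁ where
  field
    commutativeRing : CommutativeRing 0ℓ 0ℓ
  open CommutativeRing commutativeRing public
  field
    0≉1      : ¬ (0# ≈ 1#)
    _⁻¹      : Carrier → Carrier
    inverseˡ : ∀ x → ¬ (x ≈ 0#) → (x ⁻¹) * x ≈ 1#
    _≤_      : Carrier → Carrier → Set
    ≤-resp-≈ : ∀ {x x' y y'} → x ≈ x' → y ≈ y' → x ≤ y → x' ≤ y'
    ≤-refl   : ∀ x → x ≤ x
    ≤-antisym : ∀ {x y} → x ≤ y → y ≤ x → x ≈ y
    ≤-trans  : ∀ {x y z} → x ≤ y → y ≤ z → x ≤ z
    ≤-total  : ∀ x y → x ≤ y ⊎ y ≤ x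
    _≤?_     : ∀ x y → Dec (x ≤ y)
    _≟_      : ∀ x y → Dec (x ≈ y)
    +-mono-≤ : ∀ {x y} z → x ≤ y → (x + z) ≤ (y + z)
    *-nonneg : ∀ {x y} → 0# ≤ x → 0# ≤ y → 0# ≤ (x * y)
    complete : (S : Carrier → Set) → (∃ λ x → S x) →
               (∃ λ b → ∀ x → S x → x ≤ b) →
               ∃ λ s → (∀ x → S x → x ≤ s) ×
                       (∀ b → (∀ x → S x → x ≤ b) → s ≤ b)

-- Simplicial complexes on the vertex set Fin n, faces as subsets
-- (decidable membership given by a Bool-valued predicate).

record SimplicialComplex (n : ℕ) : Set where
  field
    face       : Subset n → Bool
    down-closed : ∀ {σ τ} → τ ⊆ σ → T (face σ) → T (face τ)
    -- V(Δ) = Fin n: every element of Fin n is a vertex of Δ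
    vertices   : ∀ v → T (face ⁅ v ⁆)

module _ {n : ℕ} (Δ : SimplicialComplex n) where
  open SimplicialComplex Δ

  IsFace : Subset n → Set
  IsFace σ = T (face σ)

  -- dim σ = ∣σ∣ - 1 ; we phrase dimension conditions via cardinality
  -- pure of dimension d-1: every face lies in a face with d vertices,
  -- and no face has more than d vertices.
  IsPure : ℕ → Set
  IsPure d = (∀ σ → IsFace σ → ∃ λ F → IsFace F × σ ⊆ F × ∣ F ∣ ≡ d)
           × (∀ σ → IsFace σ → ∣ σ ∣ ℕ.≤ d)

  IsFacet : ℕ → Subset n → Set
  IsFacet d F = IsFace F × ∣ F ∣ ≡ d

  Facet : ℕ → Set
  Facet d = Σ (Subset n) (IsFacet d)

  -- adjacent facets: they share a (d-2)-face, i.e. a face with d-1 vertices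
  Adjacent : (d : ℕ) → Facet d → Facet d → Set
  Adjacent d (F , _) (F' , _) = ∣ F ∩ F' ∣ ≡ d ∸ 1

  StronglyConnected : ℕ → Set
  StronglyConnected d = ∀ (F F' : Facet d) → Star (Adjacent d) F F'

  InStar : Subset n → Subset n → Set
  InStar G σ = IsFace (σ ∪ G)

module Lin (ℝ : RealField) where
  open RealField ℝ hiding (zero)

  Σᶠ : ∀ {n} → (Fin n → Carrier) → Carrier
  Σᶠ {ℕ.zero} f = 0#
  Σᶠ {suc n} f = f zero + Σᶠ (λ i → f (suc i))

  AffineDependence : ∀ {n d} → (Fin n → Fin d → Carrier) → (Fin n → Carrier) → Set
  AffineDependence p a =
    (∀ m → Σᶠ (λ v → a v * p v m) ≈ 0#) × (Σᶠ a ≈ 0#)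

  AffinelyIndependentOn : ∀ {n d} → (Fin n → Fin d → Carrier) → Subset n → Set
  AffinelyIndependentOn p S =
    ∀ a → AffineDependence p a → (∀ v → ¬ (v ∈ S) → a v ≈ 0#) → ∀ v → a v ≈ 0#

  -- Affine 1-stresses λ = Σ a_v x_v on (Γ, p), Γ given by its face
  -- predicate: monomials x_v must have support {v} a face of Γ,
  -- ∂_{θ_m} λ = Σ_v p(v)_m a_v = 0, and ∂_c λ = Σ_v a_v = 0.
  IsStress1 : ∀ {n d} → (Subset n → Set) → (Fin n → Fin d → Carrier) →
              (Fin n → Carrier) → Set
  IsStress1 Γ p a =
    (∀ v → ¬ Γ ⁅ v ⁆ → a v ≈ 0#) × AffineDependence p a

  sumVec : ∀ {n} {A : Set} → List (A × (Fin n → Carrier)) → Fin n → Carrier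
  sumVec L v = foldr (λ x s → proj₂ x v + s) 0# L

  -- a ∈ Σ_{G ∈ I} W_G  (sum of subspaces): a is a finite sum of elements
  -- b_G ∈ W_G with G ∈ I
  InSumOfSubspaces : ∀ {n : ℕ} → (Subset n → Set) → (Subset n → (Fin n → Carrier) → Set) →
                     (Fin n → Carrier) → Set
  InSumOfSubspaces I W a =
    Σ (List (Subset _ × (Fin _ → Carrier))) λ L →
      All (λ x → I (proj₁ x) × W (proj₁ x) (proj₂ x)) L ×
      (∀ v → a v ≈ sumVec L v)

-- Let W be the sum of the spaces of affine 1-stresses on stars of (d-3)-faces, and call a vector
-- reducible to a vertex set S when it agrees with an element of W outside S.  For adjacent facets
-- A, B the d + 1 points of A ∪ B are affinely independent, so for a vertex x in the star of a
-- (d-3)-face G whose star contains A ∪ B, the d + 2 points A ∪ B ∪ {x} carry an affine dependence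
-- with coefficient 1 at x; it is a stress on st(G), hence the unit vector at x is reducible to A ∪ B.
-- Consecutive pairs (A, B), (B, B') of a path of adjacent facets share a (d-3)-face in A ∩ B ∩ B',
-- so reducibility to B ∪ B' transfers to A ∪ B, and by strong connectivity every vector is
-- reducible to a single A ∪ B.  An affine dependence then differs from an element of W by an
-- affine dependence supported on A ∪ B ⊆ st(G), which is itself a star stress.  The vertex version
-- follows from st(G) ⊆ st(v) for v ∈ G.

module Submission where

open import Defs
open import Data.Nat using (ℕ; _≤_; _∸_)
open import Data.Fin using (Fin)
open import Data.Fin.Subset using (Subset; _∪_; ∣_∣)
open import Data.Product using (_×_; proj₁)
open import Relation.Binary.PropositionalEquality using (_≡_)

open import Data.Nat using (zero; suc; _<_; z≤n; s≤s)
import Data.Nat.Properties as ℕ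
open import Data.Fin using (zero; suc)
import Data.Fin.Properties as Fin
open import Data.Fin.Subset using (inside; outside; _∈_; _∉_; _⊆_; _∩_; _-_; ⁅_⁆; ⊥; Nonempty)
open import Data.Fin.Subset.Properties
  using (_∈?_; x∈p∪q⁺; x∈p∪q⁻; x∈p∩q⁻; x∈⁅x⁆; x∈⁅y⁆⇒x≡y; ∣⁅x⁆∣≡1; ∣⊥∣≡0; ∉⊥; Empty-unique; nonempty?;
         p⊆q⇒∣p∣≤∣q∣; p⊆p∪q; q⊆p∪q; p∩q⊆p; p∩q⊆q; ∩-comm; p─q⊆p; p─⊥≡p; drop-there; s⊆s; out⊆)
open import Data.Vec using ([]; _∷_)
open import Data.Vec.Functional using (Vector; removeAt)
open import Data.List using (List; []; _∷_; _++_; map)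
open import Data.List.Relation.Unary.All as All using (All; []; _∷_)
open import Data.List.Relation.Unary.All.Properties using (++⁺; map⁺)
open import Data.Product using (∃; _,_; proj₂)
open import Data.Sum using (_⊎_; inj₁; inj₂; [_,_]′)
open import Data.Unit using (⊤; tt)
open import Function using (_∘_; case_of_)
open import Relation.Nullary using (¬_; yes; no; contradiction; ¬?)
open import Relation.Nullary.Decidable using (_×-dec_; decidable-stable)
open import Relation.Binary.PropositionalEquality
  using (_≢_; refl; cong; cong₂; subst; ≢-sym; module ≡-Reasoning) renaming (sym to ≡-sym; trans to ≡-trans)
open import Relation.Binary.Construct.Closure.ReflexiveTransitive using (Star; ε; _◅_)

private
  variable
    n : ℕ

module FiniteSubsets where
  open import Data.Nat using (_+_)

  ∣p∩q∣+∣p∪q∣≡∣p∣+∣q∣ : (p q : Subset n) → ∣ p ∩ q ∣ + ∣ p ∪ q ∣ ≡ ∣ p ∣ + ∣ q ∣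
  ∣p∩q∣+∣p∪q∣≡∣p∣+∣q∣ []             []             = refl
  ∣p∩q∣+∣p∪q∣≡∣p∣+∣q∣ (inside ∷ p)  (inside ∷ q)  =
    cong suc (≡-trans (ℕ.+-suc _ _) (≡-trans (cong suc (∣p∩q∣+∣p∪q∣≡∣p∣+∣q∣ p q)) (≡-sym (ℕ.+-suc _ _))))
  ∣p∩q∣+∣p∪q∣≡∣p∣+∣q∣ (inside ∷ p)  (outside ∷ q) = ≡-trans (ℕ.+-suc _ _) (cong suc (∣p∩q∣+∣p∪q∣≡∣p∣+∣q∣ p q))
  ∣p∩q∣+∣p∪q∣≡∣p∣+∣q∣ (outside ∷ p) (inside ∷ q)  =
    ≡-trans (ℕ.+-suc _ _) (≡-trans (cong suc (∣p∩q∣+∣p∪q∣≡∣p∣+∣q∣ p q)) (≡-sym (ℕ.+-suc _ _)))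
  ∣p∩q∣+∣p∪q∣≡∣p∣+∣q∣ (outside ∷ p) (outside ∷ q) = ∣p∩q∣+∣p∪q∣≡∣p∣+∣q∣ p q

  p⊆r∧q⊆r⇒p∪q⊆r : {p q r : Subset n} → p ⊆ r → q ⊆ r → p ∪ q ⊆ r
  p⊆r∧q⊆r⇒p∪q⊆r {p = p} {q} p⊆r q⊆r x∈p∪q = [ p⊆r , q⊆r ]′ (x∈p∪q⁻ p q x∈p∪q)

  p,q⊆r⇒∣p∣+∣q∣≤∣p∩q∣+∣r∣ : {p q r : Subset n} → p ⊆ r → q ⊆ r → ∣ p ∣ + ∣ q ∣ ≤ ∣ p ∩ q ∣ + ∣ r ∣
  p,q⊆r⇒∣p∣+∣q∣≤∣p∩q∣+∣r∣ {p = p} {q} {r} p⊆r q⊆r = begin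
    ∣ p ∣ + ∣ q ∣           ≡⟨ ∣p∩q∣+∣p∪q∣≡∣p∣+∣q∣ p q ⟨
    ∣ p ∩ q ∣ + ∣ p ∪ q ∣   ≤⟨ ℕ.+-monoʳ-≤ ∣ p ∩ q ∣ (p⊆q⇒∣p∣≤∣q∣ (p⊆r∧q⊆r⇒p∪q⊆r p⊆r q⊆r)) ⟩
    ∣ p ∩ q ∣ + ∣ r ∣ ∎
    where open ℕ.≤-Reasoning

  x∈p⇒∣p∣≡1+∣p-x∣ : {p : Subset n} {x : Fin n} → x ∈ p → ∣ p ∣ ≡ suc ∣ p - x ∣
  x∈p⇒∣p∣≡1+∣p-x∣ {p = inside ∷ p}  {zero}  _   = cong (suc ∘ ∣_∣) (≡-sym (p─⊥≡p p))
  x∈p⇒∣p∣≡1+∣p-x∣ {p = inside ∷ p}  {suc x} x∈p = cong suc (x∈p⇒∣p∣≡1+∣p-x∣ (drop-there x∈p))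
  x∈p⇒∣p∣≡1+∣p-x∣ {p = outside ∷ p} {suc x} x∈p = x∈p⇒∣p∣≡1+∣p-x∣ (drop-there x∈p)

  x∉p⇒∣p∪⁅x⁆∣≡1+∣p∣ : {p : Subset n} {x : Fin n} → x ∉ p → ∣ p ∪ ⁅ x ⁆ ∣ ≡ suc ∣ p ∣
  x∉p⇒∣p∪⁅x⁆∣≡1+∣p∣ {n} {p} {x} x∉p = begin
    ∣ p ∪ ⁅ x ⁆ ∣                     ≡⟨⟩
    0 + ∣ p ∪ ⁅ x ⁆ ∣                 ≡⟨ cong (_+ ∣ p ∪ ⁅ x ⁆ ∣) ∣p∩⁅x⁆∣≡0 ⟨
    ∣ p ∩ ⁅ x ⁆ ∣ + ∣ p ∪ ⁅ x ⁆ ∣     ≡⟨ ∣p∩q∣+∣p∪q∣≡∣p∣+∣q∣ p ⁅ x ⁆ ⟩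
    ∣ p ∣ + ∣ ⁅ x ⁆ ∣                 ≡⟨ cong (∣ p ∣ +_) (∣⁅x⁆∣≡1 x) ⟩
    ∣ p ∣ + 1                         ≡⟨ ℕ.+-comm ∣ p ∣ 1 ⟩
    suc ∣ p ∣ ∎
    where
    open ≡-Reasoning
    ∣p∩⁅x⁆∣≡0 : ∣ p ∩ ⁅ x ⁆ ∣ ≡ 0
    ∣p∩⁅x⁆∣≡0 = ≡-trans (cong ∣_∣ (Empty-unique λ (y , y∈) →
      let y∈p , y∈⁅x⁆ = x∈p∩q⁻ p ⁅ x ⁆ y∈ in x∉p (subst (_∈ p) (x∈⁅y⁆⇒x≡y x y∈⁅x⁆) y∈p))) (∣⊥∣≡0 n)

  0<∣p∣⇒Nonempty : {p : Subset n} → 0 < ∣ p ∣ → Nonempty p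
  0<∣p∣⇒Nonempty {n} {p} 0<∣p∣ with nonempty? p
  ... | yes nonempty = nonempty
  ... | no  empty    =
    contradiction (subst (λ q → 0 < ∣ q ∣) (Empty-unique empty) 0<∣p∣) (ℕ.<-irrefl (≡-sym (∣⊥∣≡0 n)))

  ∃-⊆-of-size : ∀ k (p : Subset n) → k ≤ ∣ p ∣ → ∃ λ q → q ⊆ p × ∣ q ∣ ≡ k
  ∃-⊆-of-size {n} zero    p             _        = ⊥ , (λ x∈⊥ → contradiction x∈⊥ ∉⊥) , ∣⊥∣≡0 n
  ∃-⊆-of-size (suc k) (inside ∷ p)  (s≤s k≤) with ∃-⊆-of-size k p k≤
  ... | q , q⊆p , ∣q∣≡k = inside ∷ q , s⊆s q⊆p , cong suc ∣q∣≡k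
  ∃-⊆-of-size (suc k) (outside ∷ p) k<       with ∃-⊆-of-size (suc k) p k<
  ... | q , q⊆p , ∣q∣≡k = outside ∷ q , out⊆ q⊆p , ∣q∣≡k

  x∉p-x : ∀ (p : Subset n) x → x ∉ p - x
  x∉p-x (inside ∷ p)  zero    ()
  x∉p-x (outside ∷ p) zero    ()
  x∉p-x (s ∷ p)       (suc x) x∈p-x = x∉p-x p x (drop-there x∈p-x)

  ∣p∪q∣≡3+k : ∀ {k} (p q : Subset n) → ∣ p ∣ ≡ 2 + k → ∣ q ∣ ≡ 2 + k → ∣ p ∩ q ∣ ≡ 1 + k → ∣ p ∪ q ∣ ≡ 3 + k
  ∣p∪q∣≡3+k {k = k} p q ∣p∣≡2+k ∣q∣≡2+k ∣p∩q∣≡1+k = ℕ.+-cancelˡ-≡ (1 + k) _ _ (begin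
    (1 + k) + ∣ p ∪ q ∣      ≡⟨ cong (_+ ∣ p ∪ q ∣) ∣p∩q∣≡1+k ⟨
    ∣ p ∩ q ∣ + ∣ p ∪ q ∣    ≡⟨ ∣p∩q∣+∣p∪q∣≡∣p∣+∣q∣ p q ⟩
    ∣ p ∣ + ∣ q ∣            ≡⟨ cong₂ _+_ ∣p∣≡2+k ∣q∣≡2+k ⟩
    (2 + k) + (2 + k)        ≡⟨ cong suc (ℕ.+-suc k (2 + k)) ⟨
    (1 + k) + (3 + k)        ∎)
    where open ≡-Reasoning

  ∃-⊆-common-of-size : ∀ {k} (p q r : Subset n) → ∣ p ∣ ≡ 2 + k → ∣ p ∩ q ∣ ≡ 1 + k → ∣ p ∩ r ∣ ≡ 1 + k →
                        ∃ λ s → s ⊆ p × s ⊆ q × s ⊆ r × ∣ s ∣ ≡ k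
  ∃-⊆-common-of-size {k = k} p q r ∣p∣≡2+k ∣p∩q∣≡1+k ∣p∩r∣≡1+k =
    let s , s⊆p∩q∩r , ∣s∣≡k = ∃-⊆-of-size k ((p ∩ q) ∩ (p ∩ r)) k≤∣p∩q∩r∣
    in  s , p∩q⊆p p q ∘ p∩q⊆p _ _ ∘ s⊆p∩q∩r , p∩q⊆q p q ∘ p∩q⊆p _ _ ∘ s⊆p∩q∩r ,
            p∩q⊆q p r ∘ p∩q⊆q _ _ ∘ s⊆p∩q∩r , ∣s∣≡k
    where
    k≤∣p∩q∩r∣ : k ≤ ∣ (p ∩ q) ∩ (p ∩ r) ∣
    k≤∣p∩q∩r∣ = ℕ.+-cancelʳ-≤ (2 + k) k _ (begin
      k + (2 + k)                              ≡⟨ ℕ.+-suc k (1 + k) ⟩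
      (1 + k) + (1 + k)                        ≡⟨ cong₂ _+_ ∣p∩q∣≡1+k ∣p∩r∣≡1+k ⟨
      ∣ p ∩ q ∣ + ∣ p ∩ r ∣                    ≤⟨ p,q⊆r⇒∣p∣+∣q∣≤∣p∩q∣+∣r∣ (p∩q⊆p p q) (p∩q⊆p p r) ⟩
      ∣ (p ∩ q) ∩ (p ∩ r) ∣ + ∣ p ∣            ≡⟨ cong (∣ (p ∩ q) ∩ (p ∩ r) ∣ +_) ∣p∣≡2+k ⟩
      ∣ (p ∩ q) ∩ (p ∩ r) ∣ + (2 + k)          ∎)
      where open ℕ.≤-Reasoning

  x∈p⇒⁅x⁆⊆p : {p : Subset n} {x : Fin n} → x ∈ p → ⁅ x ⁆ ⊆ p
  x∈p⇒⁅x⁆⊆p {p = p} {x} x∈p y∈⁅x⁆ = subst (_∈ p) (≡-sym (x∈⁅y⁆⇒x≡y x y∈⁅x⁆)) x∈p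

  x∉p∧x≢y⇒x∉p∪⁅y⁆ : {p : Subset n} {x y : Fin n} → x ∉ p → x ≢ y → x ∉ p ∪ ⁅ y ⁆
  x∉p∧x≢y⇒x∉p∪⁅y⁆ {p = p} {y = y} x∉p x≢y x∈p∪⁅y⁆ = [ x∉p , x≢y ∘ x∈⁅y⁆⇒x≡y y ]′ (x∈p∪q⁻ p ⁅ y ⁆ x∈p∪⁅y⁆)

open FiniteSubsets

module LinearAlgebra (ℝ : RealField) where
  open RealField ℝ hiding (zero; refl; sym; trans; _≤_; ≤-refl; ≤-trans; ≤-antisym; ≤-total; _≤?_; ≤-resp-≈; _-_)
  open RealField ℝ using () renaming (refl to ≈-refl; sym to ≈-sym; trans to ≈-trans)
  open Lin ℝ
  open import Algebra.Properties.Ring ring using (-‿distribˡ-*; -1*x≈-x)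
  open import Algebra.Properties.Semiring.Sum semiring
    using (sum; ∑-distrib-+; *-distribˡ-sum; sum-cong-≋; sum-remove; sum-replicate-zero)
  open import Data.Vec.Functional.Relation.Binary.Equality.Setoid setoid using (_≋_)
  open import Relation.Binary.Reasoning.Setoid setoid

  private
    variable
      k : ℕ
      a b : Vector Carrier n

  infixl 6 _+ᵛ_ _-ᵛ_
  infixr 7 _·ᵛ_

  _+ᵛ_ : Vector Carrier n → Vector Carrier n → Vector Carrier n
  (a +ᵛ b) v = a v + b v

  _·ᵛ_ : Carrier → Vector Carrier n → Vector Carrier n
  (c ·ᵛ a) v = c * a v

  _-ᵛ_ : Vector Carrier n → Vector Carrier n → Vector Carrier n
  a -ᵛ b = a +ᵛ (- 1#) ·ᵛ b

  0ᵛ : Vector Carrier n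
  0ᵛ _ = 0#

  δ : Fin n → Vector Carrier n
  δ i v with v Fin.≟ i
  ... | yes _ = 1#
  ... | no  _ = 0#

  δ-diag : (i : Fin n) → δ i i ≈ 1#
  δ-diag i with i Fin.≟ i
  ... | yes _   = ≈-refl
  ... | no  i≢i = contradiction refl i≢i

  δ-off : {i v : Fin n} → v ≢ i → δ i v ≈ 0#
  δ-off {i = i} {v} v≢i with v Fin.≟ i
  ... | yes v≡i = contradiction v≡i v≢i
  ... | no  _   = ≈-refl

  ⟨_,_⟩ : Vector Carrier n → Vector Carrier n → Carrier
  ⟨ a , g ⟩ = Σᶠ (λ v → a v * g v)

  column : (Fin n → Fin k → Carrier) → Fin k → Vector Carrier n
  column w m v = w v m

  SupportedIn : (Fin n → Set) → Vector Carrier n → Set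
  SupportedIn P a = ∀ v → ¬ P v → a v ≈ 0#

  LinearRelation : (Fin n → Fin k → Carrier) → Vector Carrier n → Set
  LinearRelation w a = ∀ m → ⟨ a , column w m ⟩ ≈ 0#

  Nontrivial : Vector Carrier n → Set
  Nontrivial a = ∃ λ v → ¬ a v ≈ 0#

  Σᶠ≡sum : (f : Vector Carrier n) → Σᶠ f ≡ sum f
  Σᶠ≡sum {zero}  f = refl
  Σᶠ≡sum {suc n} f = cong (f zero +_) (Σᶠ≡sum (λ i → f (suc i)))

  Σᶠ-cong : {f g : Vector Carrier n} → f ≋ g → Σᶠ f ≈ Σᶠ g
  Σᶠ-cong {f = f} {g} f≋g = begin
    Σᶠ f ≡⟨ Σᶠ≡sum f ⟩ sum f ≈⟨ sum-cong-≋ f≋g ⟩ sum g ≡⟨ Σᶠ≡sum g ⟨ Σᶠ g ∎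

  Σᶠ-lincomb : ∀ (f g : Vector Carrier n) c → Σᶠ (f +ᵛ c ·ᵛ g) ≈ Σᶠ f + c * Σᶠ g
  Σᶠ-lincomb f g c = begin
    Σᶠ (f +ᵛ c ·ᵛ g)        ≡⟨ Σᶠ≡sum (f +ᵛ c ·ᵛ g) ⟩
    sum (f +ᵛ c ·ᵛ g)       ≈⟨ ∑-distrib-+ f (c ·ᵛ g) ⟩
    sum f + sum (c ·ᵛ g)    ≈⟨ +-congˡ (*-distribˡ-sum c g) ⟨
    sum f + c * sum g       ≡⟨ cong₂ (λ x y → x + c * y) (Σᶠ≡sum f) (Σᶠ≡sum g) ⟨
    Σᶠ f + c * Σᶠ g ∎

  Σᶠ-zero : {f : Vector Carrier n} → f ≋ 0ᵛ → Σᶠ f ≈ 0#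
  Σᶠ-zero {n} {f} f≋0 = ≈-trans (Σᶠ-cong f≋0) (≈-trans (reflexive (Σᶠ≡sum {n} 0ᵛ)) (sum-replicate-zero n))

  Σᶠ-concentrated : ∀ (f : Vector Carrier n) i → (∀ v → v ≢ i → f v ≈ 0#) → Σᶠ f ≈ f i
  Σᶠ-concentrated {suc n} f i off-i = begin
    Σᶠ f                          ≡⟨ Σᶠ≡sum f ⟩
    sum f                         ≈⟨ sum-remove {i = i} f ⟩
    f i + sum (removeAt f i)      ≡⟨ cong (f i +_) (Σᶠ≡sum (removeAt f i)) ⟨
    f i + Σᶠ (removeAt f i)       ≈⟨ +-congˡ (Σᶠ-zero (λ j → off-i _ (Fin.punchInᵢ≢i i j))) ⟩
    f i + 0#                      ≈⟨ +-identityʳ (f i) ⟩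
    f i ∎

  ⟨⟩-lincombˡ : ∀ (a b g : Vector Carrier n) c → ⟨ a +ᵛ c ·ᵛ b , g ⟩ ≈ ⟨ a , g ⟩ + c * ⟨ b , g ⟩
  ⟨⟩-lincombˡ a b g c = ≈-trans (Σᶠ-cong pointwise) (Σᶠ-lincomb (λ v → a v * g v) (λ v → b v * g v) c)
    where
    pointwise : ∀ v → (a v + c * b v) * g v ≈ a v * g v + c * (b v * g v)
    pointwise v = ≈-trans (distribʳ (g v) (a v) (c * b v)) (+-congˡ (*-assoc c (b v) (g v)))

  ⟨⟩-comm : ∀ (a g : Vector Carrier n) → ⟨ a , g ⟩ ≈ ⟨ g , a ⟩
  ⟨⟩-comm a g = Σᶠ-cong (λ v → *-comm (a v) (g v))

  ⟨⟩-lincombʳ : ∀ (a g h : Vector Carrier n) c → ⟨ a , g +ᵛ c ·ᵛ h ⟩ ≈ ⟨ a , g ⟩ + c * ⟨ a , h ⟩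
  ⟨⟩-lincombʳ a g h c = begin
    ⟨ a , g +ᵛ c ·ᵛ h ⟩        ≈⟨ ⟨⟩-comm a _ ⟩
    ⟨ g +ᵛ c ·ᵛ h , a ⟩        ≈⟨ ⟨⟩-lincombˡ g h a c ⟩
    ⟨ g , a ⟩ + c * ⟨ h , a ⟩  ≈⟨ +-cong (⟨⟩-comm g a) (*-congˡ (⟨⟩-comm h a)) ⟩
    ⟨ a , g ⟩ + c * ⟨ a , h ⟩  ∎

  ⟨δ,-⟩ : ∀ (i : Fin n) g → ⟨ δ i , g ⟩ ≈ g i
  ⟨δ,-⟩ i g = begin
    ⟨ δ i , g ⟩   ≈⟨ Σᶠ-concentrated (λ v → δ i v * g v) i
                       (λ v v≢i → ≈-trans (*-congʳ (δ-off v≢i)) (zeroˡ (g v))) ⟩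
    δ i i * g i   ≈⟨ *-congʳ (δ-diag i) ⟩
    1# * g i      ≈⟨ *-identityˡ (g i) ⟩
    g i           ∎

  ⟨⟩-disjoint : ∀ (a g : Vector Carrier n) → (∀ v → a v ≈ 0# ⊎ g v ≈ 0#) → ⟨ a , g ⟩ ≈ 0#
  ⟨⟩-disjoint a g a⊎g = Σᶠ-zero λ v → case a⊎g v of λ where
    (inj₁ av≈0) → ≈-trans (*-congʳ av≈0) (zeroˡ (g v))
    (inj₂ gv≈0) → ≈-trans (*-congˡ gv≈0) (zeroʳ (a v))

  δ-expansion : (a : Vector Carrier n) → a ≋ (λ v → Σᶠ (λ y → a y * δ y v))
  δ-expansion a v = ≈-sym (begin
    Σᶠ (λ y → a y * δ y v)  ≈⟨ Σᶠ-concentrated (λ y → a y * δ y v) v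
                                 (λ y y≢v → ≈-trans (*-congˡ (δ-off (≢-sym y≢v))) (zeroʳ (a y))) ⟩
    a v * δ v v             ≈⟨ *-congˡ (δ-diag v) ⟩
    a v * 1#                ≈⟨ *-identityʳ (a v) ⟩
    a v                     ∎)

  record IsSubspace (U : Vector Carrier n → Set) : Set where
    field
      ≋-closed       : a ≋ b → U a → U b
      0ᵛ-closed      : U 0ᵛ
      lincomb-closed : ∀ c → U a → U b → U (a +ᵛ c ·ᵛ b)

    +-closed : U a → U b → U (a +ᵛ b)
    +-closed ua ub = ≋-closed (λ v → +-congˡ (*-identityˡ _)) (lincomb-closed 1# ua ub)

    ·-closed : ∀ c → U a → U (c ·ᵛ a)
    ·-closed c ua = ≋-closed (λ v → +-identityˡ _) (lincomb-closed c 0ᵛ-closed ua)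

    -ᵛ-closed : U a → U b → U (a -ᵛ b)
    -ᵛ-closed = lincomb-closed (- 1#)

    Σᶠ-closed : ∀ {m} (f : Fin m → Vector Carrier n) → (∀ i → U (f i)) → U (λ v → Σᶠ (λ i → f i v))
    Σᶠ-closed {zero}  f _  = 0ᵛ-closed
    Σᶠ-closed {suc m} f Uf = +-closed (Uf zero) (Σᶠ-closed (λ i → f (suc i)) (λ i → Uf (suc i)))

    spanned-by-δ : (∀ y → a y ≈ 0# ⊎ U (δ y)) → U a
    spanned-by-δ {a = a} coordinate =
      ≋-closed (λ v → ≈-sym (δ-expansion a v)) (Σᶠ-closed (λ y → a y ·ᵛ δ y) term)
      where
      term : ∀ y → U (a y ·ᵛ δ y)
      term y with coordinate y
      ... | inj₁ ay≈0 = ≋-closed (λ v → ≈-sym (≈-trans (*-congʳ ay≈0) (zeroˡ (δ y v)))) 0ᵛ-closed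
      ... | inj₂ Uδy  = ·-closed (a y) Uδy

  open IsSubspace public

  lincomb-≈0 : ∀ {x y} c → x ≈ 0# → y ≈ 0# → x + c * y ≈ 0#
  lincomb-≈0 {x} {y} c x≈0 y≈0 = begin
    x + c * y    ≈⟨ +-cong x≈0 (*-congˡ y≈0) ⟩
    0# + c * 0#  ≈⟨ +-identityˡ _ ⟩
    c * 0#       ≈⟨ zeroʳ c ⟩
    0#           ∎

  supportedIn-isSubspace : (P : Fin n → Set) → IsSubspace (SupportedIn P)
  supportedIn-isSubspace P = record
    { ≋-closed       = λ a≋b Pa v ¬Pv → ≈-trans (≈-sym (a≋b v)) (Pa v ¬Pv)
    ; 0ᵛ-closed      = λ _ _ → ≈-refl
    ; lincomb-closed = λ c Pa Pb v ¬Pv → lincomb-≈0 c (Pa v ¬Pv) (Pb v ¬Pv)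
    }

  kernel-isSubspace : (g : Vector Carrier n) → IsSubspace (λ a → ⟨ a , g ⟩ ≈ 0#)
  kernel-isSubspace g = record
    { ≋-closed       = λ a≋b ag≈0 → ≈-trans (Σᶠ-cong (λ v → *-congʳ (≈-sym (a≋b v)))) ag≈0
    ; 0ᵛ-closed      = Σᶠ-zero (λ v → zeroˡ (g v))
    ; lincomb-closed = λ c ag≈0 bg≈0 → ≈-trans (⟨⟩-lincombˡ _ _ g c) (lincomb-≈0 c ag≈0 bg≈0)
    }

  Σᶠ-kernel-isSubspace : IsSubspace {n} (λ a → Σᶠ a ≈ 0#)
  Σᶠ-kernel-isSubspace {n} = record
    { ≋-closed       = λ a≋b Σa≈0 → ≈-trans (Σᶠ-cong (λ v → ≈-sym (a≋b v))) Σa≈0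
    ; 0ᵛ-closed      = Σᶠ-zero {n} (λ _ → ≈-refl)
    ; lincomb-closed = λ {a} {b} c Σa≈0 Σb≈0 → ≈-trans (Σᶠ-lincomb a b c) (lincomb-≈0 c Σa≈0 Σb≈0)
    }

  ×-isSubspace : {U U′ : Vector Carrier n → Set} → IsSubspace U → IsSubspace U′ →
                 IsSubspace (λ a → U a × U′ a)
  ×-isSubspace U U′ = record
    { ≋-closed       = λ a≋b (Ua , U′a) → ≋-closed U a≋b Ua , ≋-closed U′ a≋b U′a
    ; 0ᵛ-closed      = 0ᵛ-closed U , 0ᵛ-closed U′
    ; lincomb-closed = λ c (Ua , U′a) (Ub , U′b) → lincomb-closed U c Ua Ub , lincomb-closed U′ c U′a U′b
    }

  Π-isSubspace : {M : Set} {U : M → Vector Carrier n → Set} → (∀ m → IsSubspace (U m)) →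
                 IsSubspace (λ a → ∀ m → U m a)
  Π-isSubspace U = record
    { ≋-closed       = λ a≋b Ua m → ≋-closed (U m) a≋b (Ua m)
    ; 0ᵛ-closed      = λ m → 0ᵛ-closed (U m)
    ; lincomb-closed = λ c Ua Ub m → lincomb-closed (U m) c (Ua m) (Ub m)
    }

  linearRelation-isSubspace : (w : Fin n → Fin k → Carrier) → IsSubspace (LinearRelation w)
  linearRelation-isSubspace w = Π-isSubspace (λ m → kernel-isSubspace (column w m))

  affineDependence-isSubspace : (p : Fin n → Fin k → Carrier) → IsSubspace (AffineDependence p)
  affineDependence-isSubspace p = ×-isSubspace (linearRelation-isSubspace p) Σᶠ-kernel-isSubspace

  stress-isSubspace : (Γ : Subset n → Set) (p : Fin n → Fin k → Carrier) → IsSubspace (IsStress1 Γ p)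
  stress-isSubspace Γ p = ×-isSubspace (supportedIn-isSubspace (λ v → Γ ⁅ v ⁆)) (affineDependence-isSubspace p)

  module _ {I : Subset n → Set} {W : Subset n → Vector Carrier n → Set} where

    private
      Terms : Set
      Terms = List (Subset n × Vector Carrier n)

      scaleTerms : Carrier → Terms → Terms
      scaleTerms c = map (λ (G , b) → G , c ·ᵛ b)

      sumVec-++ : ∀ (L M : Terms) v → sumVec (L ++ M) v ≈ sumVec L v + sumVec M v
      sumVec-++ []      M v = ≈-sym (+-identityˡ _)
      sumVec-++ (x ∷ L) M v = ≈-trans (+-congˡ (sumVec-++ L M v)) (≈-sym (+-assoc _ _ _))

      sumVec-scale : ∀ c (L : Terms) v → sumVec (scaleTerms c L) v ≈ c * sumVec L v
      sumVec-scale c []      v = ≈-sym (zeroʳ c)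
      sumVec-scale c (x ∷ L) v = ≈-trans (+-congˡ (sumVec-scale c L v)) (≈-sym (distribˡ c _ _))

    inSum-isSubspace : (∀ G → IsSubspace (W G)) → IsSubspace (InSumOfSubspaces I W)
    inSum-isSubspace W-sub = record
      { ≋-closed       = λ a≋b (L , ok , a≈L) → L , ok , λ v → ≈-trans (≈-sym (a≋b v)) (a≈L v)
      ; 0ᵛ-closed      = [] , [] , λ _ → ≈-refl
      ; lincomb-closed = λ c (L , okL , a≈L) (M , okM , b≈M) →
          L ++ scaleTerms c M ,
          ++⁺ okL (map⁺ (All.map (λ {x} (IG , Wb) → IG , ·-closed (W-sub (proj₁ x)) c Wb) okM)) ,
          λ v → ≈-trans (+-cong (a≈L v) (≈-trans (*-congˡ (b≈M v)) (≈-sym (sumVec-scale c M v))))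
                        (≈-sym (sumVec-++ L _ v))
      }

    ∈⇒inSum : ∀ {G} → I G → W G a → InSumOfSubspaces I W a
    ∈⇒inSum {G = G} IG Wa = (G , _) ∷ [] , (IG , Wa) ∷ [] , λ v → ≈-sym (+-identityʳ _)

    inSum-least : {U : Vector Carrier n → Set} → IsSubspace U →
                  (∀ {G b} → I G → W G b → U b) → InSumOfSubspaces I W a → U a
    inSum-least {U = U} U-sub W⊆U (L , ok , a≈L) = ≋-closed U-sub (λ v → ≈-sym (a≈L v)) (sum-closed L ok)
      where
      sum-closed : (L : Terms) → All (λ x → I (proj₁ x) × W (proj₁ x) (proj₂ x)) L → U (sumVec L)
      sum-closed []      []              = 0ᵛ-closed U-sub
      sum-closed (_ ∷ L) ((IG , Wb) ∷ ok) = +-closed U-sub (W⊆U IG Wb) (sum-closed L ok)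

  supportedIn-mono : {P Q : Fin n → Set} → (∀ {v} → P v → Q v) → SupportedIn P a → SupportedIn Q a
  supportedIn-mono P⊆Q Pa v ¬Qv = Pa v (λ Pv → ¬Qv (P⊆Q Pv))

  δ-supportedIn : {P : Fin n → Set} {i : Fin n} → P i → SupportedIn P (δ i)
  δ-supportedIn {P = P} Pi v ¬Pv = δ-off (λ v≡i → ¬Pv (subst P (≡-sym v≡i) Pi))

  δ-nontrivial : (i : Fin n) → Nontrivial (δ i)
  δ-nontrivial i = i , λ δii≈0 → 0≉1 (≈-trans (≈-sym δii≈0) (δ-diag i))

  -- Row reduction with pivot w i 0: row v becomes w v (1+m) - (w v 0 / w i 0) * w i (1+m).
  eliminate : (w : Fin n → Fin (suc k) → Carrier) → Fin n → Fin n → Fin k → Carrier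
  eliminate w i v m = w v (suc m) + (w i (suc m) * - (w i zero ⁻¹)) * w v zero

  eliminate-relation : (w : Fin n → Fin (suc k) → Carrier) (i : Fin n) → ¬ w i zero ≈ 0# →
                       ∀ c → LinearRelation (eliminate w i) c →
                       LinearRelation w (c +ᵛ (⟨ c , column w zero ⟩ * - (w i zero ⁻¹)) ·ᵛ δ i)
  eliminate-relation w i wi≉0 c rel = λ where
      zero → begin
        ⟨ c +ᵛ (X * ν) ·ᵛ δ i , l ⟩    ≈⟨ ⟨⟩+δ l ⟩
        X + (X * ν) * l i             ≈⟨ +-congˡ (*-assoc X ν (l i)) ⟩
        X + X * (ν * l i)             ≈⟨ +-congˡ (*-congˡ ν*li≈-1) ⟩
        X + X * - 1#                  ≈⟨ +-congˡ (≈-trans (*-comm X _) (-1*x≈-x X)) ⟩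
        X + - X                       ≈⟨ -‿inverseʳ X ⟩
        0#                            ∎
      (suc m) → let W = w i (suc m); A = ⟨ c , column w (suc m) ⟩ in begin
        ⟨ c +ᵛ (X * ν) ·ᵛ δ i , column w (suc m) ⟩  ≈⟨ ⟨⟩+δ (column w (suc m)) ⟩
        A + (X * ν) * W                              ≈⟨ +-congˡ (≈-trans (*-assoc X ν W)
                                                          (≈-trans (*-comm X _) (*-congʳ (*-comm ν W)))) ⟩
        A + (W * ν) * X                              ≈⟨ ⟨⟩-lincombʳ c (column w (suc m)) l (W * ν) ⟨
        ⟨ c , column (eliminate w i) m ⟩             ≈⟨ rel m ⟩
        0#                                           ∎
    where
    l = column w zero
    ν = - (w i zero ⁻¹)
    X = ⟨ c , l ⟩
    ν*li≈-1 : ν * l i ≈ - 1#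
    ν*li≈-1 = ≈-trans (≈-sym (-‿distribˡ-* _ _)) (-‿cong (inverseˡ (l i) wi≉0))
    ⟨⟩+δ : ∀ g → ⟨ c +ᵛ (X * ν) ·ᵛ δ i , g ⟩ ≈ ⟨ c , g ⟩ + (X * ν) * g i
    ⟨⟩+δ g = ≈-trans (⟨⟩-lincombˡ c (δ i) g (X * ν)) (+-congˡ (*-congˡ (⟨δ,-⟩ i g)))

  ∃-nontrivialRelation : ∀ k (w : Fin n → Fin k → Carrier) (S : Subset n) → k < ∣ S ∣ →
                         ∃ λ c → SupportedIn (_∈ S) c × LinearRelation w c × Nontrivial c
  ∃-nontrivialRelation zero w S 0<∣S∣ with 0<∣p∣⇒Nonempty 0<∣S∣
  ... | i , i∈S = δ i , δ-supportedIn i∈S , (λ ()) , δ-nontrivial i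
  ∃-nontrivialRelation (suc k) w S k<∣S∣
    with Fin.any? (λ v → (v ∈? S) ×-dec ¬? (w v zero ≟ 0#))
  ... | yes (i , i∈S , wi≉0)
    with ∃-nontrivialRelation k (eliminate w i) (S - i)
           (ℕ.≤-pred (subst (suc k <_) (x∈p⇒∣p∣≡1+∣p-x∣ i∈S) k<∣S∣))
  ...   | c , c-supp , c-rel , (v , cv≉0) =
    c +ᵛ t ·ᵛ δ i ,
    lincomb-closed (supportedIn-isSubspace _) t (supportedIn-mono (p─q⊆p S _) c-supp) (δ-supportedIn i∈S) ,
    eliminate-relation w i wi≉0 c c-rel ,
    (v , λ cv+tδiv≈0 → cv≉0 (≈-trans (≈-sym δi-vanishes-at-v) cv+tδiv≈0))
    where
    t = ⟨ c , column w zero ⟩ * - (w i zero ⁻¹)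
    v≢i : v ≢ i
    v≢i v≡i = cv≉0 (c-supp v (subst (_∉ S - i) (≡-sym v≡i) (x∉p-x S i)))
    δi-vanishes-at-v : c v + t * δ i v ≈ c v
    δi-vanishes-at-v = ≈-trans (+-congˡ (≈-trans (*-congˡ (δ-off v≢i)) (zeroʳ t))) (+-identityʳ (c v))
  ∃-nontrivialRelation (suc k) w S k<∣S∣ | no no-pivot
    with ∃-nontrivialRelation k (λ v m → w v (suc m)) S (ℕ.<-trans (ℕ.n<1+n k) k<∣S∣)
  ... | c , c-supp , c-rel , c-nontriv = c , c-supp , rel , c-nontriv
    where
    rel : LinearRelation w c
    rel zero    = ⟨⟩-disjoint c (column w zero) λ v → case v ∈? S of λ where
      (yes v∈S) → inj₂ (decidable-stable (w v zero ≟ 0#) (λ wv≉0 → no-pivot (v , v∈S , wv≉0)))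
      (no  v∉S) → inj₁ (c-supp v v∉S)
    rel (suc m) = c-rel m

  homogenize : (Fin n → Fin k → Carrier) → Fin n → Fin (suc k) → Carrier
  homogenize p v zero    = 1#
  homogenize p v (suc m) = p v m

  homogeneousRelation⇒affineDependence : (p : Fin n → Fin k → Carrier) →
                                         LinearRelation (homogenize p) a → AffineDependence p a
  homogeneousRelation⇒affineDependence {n} {a = a} p rel =
    (λ m → rel (suc m)) , ≈-trans (Σᶠ-cong {n} (λ v → ≈-sym (*-identityʳ (a v)))) (rel zero)

  ∃-affineDependence-normalisedAt : (p : Fin n → Fin k → Carrier) {S : Subset n} {x : Fin n} →
    AffinelyIndependentOn p S → ∣ S ∣ ≡ suc k → x ∉ S →
    ∃ λ c → AffineDependence p c × SupportedIn (_∈ S ∪ ⁅ x ⁆) c × c x ≈ 1#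
  ∃-affineDependence-normalisedAt {k = k} p {S} {x} S-indep ∣S∣≡1+k x∉S
    with ∃-nontrivialRelation (suc k) (homogenize p) (S ∪ ⁅ x ⁆)
           (ℕ.≤-reflexive (≡-sym (≡-trans (x∉p⇒∣p∪⁅x⁆∣≡1+∣p∣ x∉S) (cong suc ∣S∣≡1+k))))
  ... | c , c-supp , c-rel , (v , cv≉0) =
    (c x ⁻¹) ·ᵛ c ,
    ·-closed (affineDependence-isSubspace p) _ c-dep ,
    ·-closed (supportedIn-isSubspace _) _ c-supp ,
    inverseˡ (c x) cx≉0
    where
    c-dep : AffineDependence p c
    c-dep = homogeneousRelation⇒affineDependence p c-rel
    cx≉0 : ¬ c x ≈ 0#
    cx≉0 cx≈0 = cv≉0 (S-indep c c-dep supported-in-S v)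
      where
      supported-in-S : SupportedIn (_∈ S) c
      supported-in-S y y∉S with y Fin.≟ x
      ... | yes refl = cx≈0
      ... | no  y≢x  = c-supp y (x∉p∧x≢y⇒x∉p∪⁅y⁆ y∉S y≢x)

  x-y+y≈x : ∀ x y → (x + - 1# * y) + y ≈ x
  x-y+y≈x x y = begin
    (x + - 1# * y) + y  ≈⟨ +-congʳ (+-congˡ (-1*x≈-x y)) ⟩
    (x + - y) + y       ≈⟨ +-assoc x (- y) y ⟩
    x + (- y + y)       ≈⟨ +-congˡ (-‿inverseˡ y) ⟩
    x + 0#              ≈⟨ +-identityʳ x ⟩
    x                   ∎

  x≈y⇒x-y≈0 : ∀ {x y} → x ≈ y → x + - 1# * y ≈ 0#
  x≈y⇒x-y≈0 {x} {y} x≈y = begin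
    x + - 1# * y  ≈⟨ +-cong x≈y (-1*x≈-x y) ⟩
    y + - y       ≈⟨ -‿inverseʳ y ⟩
    0#            ∎

  module Reduction {W : Vector Carrier n → Set} (W-sub : IsSubspace W) where

    ReducibleTo : Subset n → Vector Carrier n → Set
    ReducibleTo S a = ∃ λ w → W w × (∀ v → v ∉ S → a v ≈ w v)

    reducibleTo-isSubspace : (S : Subset n) → IsSubspace (ReducibleTo S)
    reducibleTo-isSubspace S = record
      { ≋-closed       = λ a≋b (w , Ww , a≈w) → w , Ww , λ v v∉S → ≈-trans (≈-sym (a≋b v)) (a≈w v v∉S)
      ; 0ᵛ-closed      = 0ᵛ , 0ᵛ-closed W-sub , λ _ _ → ≈-refl
      ; lincomb-closed = λ c (w , Ww , a≈w) (w′ , Ww′ , b≈w′) →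
          w +ᵛ c ·ᵛ w′ , lincomb-closed W-sub c Ww Ww′ ,
          λ v v∉S → +-cong (a≈w v v∉S) (*-congˡ (b≈w′ v v∉S))
      }

    ∈W⇒reducibleTo : ∀ {S} → W a → ReducibleTo S a
    ∈W⇒reducibleTo {a = a} Wa = a , Wa , λ _ _ → ≈-refl

    ∈⇒δ-reducibleTo : ∀ {S x} → x ∈ S → ReducibleTo S (δ x)
    ∈⇒δ-reducibleTo x∈S = 0ᵛ , 0ᵛ-closed W-sub , δ-supportedIn x∈S

    reducibleTo-trans : ∀ {S T} → ReducibleTo T a → (∀ y → y ∈ T → ReducibleTo S (δ y)) → ReducibleTo S a
    reducibleTo-trans {a = a} {S} {T} (w , Ww , a≈w) T-reducible =
      ≋-closed R (λ v → x-y+y≈x (a v) (w v)) (+-closed R (spanned-by-δ R coordinate) (∈W⇒reducibleTo Ww))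
      where
      R = reducibleTo-isSubspace S
      coordinate : ∀ y → (a -ᵛ w) y ≈ 0# ⊎ ReducibleTo S (δ y)
      coordinate y with y ∈? T
      ... | yes y∈T = inj₂ (T-reducible y y∈T)
      ... | no  y∉T = inj₁ (x≈y⇒x-y≈0 (a≈w y y∉T))

    reducibleTo⇒∈W : ∀ {S} {U : Vector Carrier n → Set} → IsSubspace U → (∀ {b} → W b → U b) →
                     (∀ {b} → U b → SupportedIn (_∈ S) b → W b) → ReducibleTo S a → U a → W a
    reducibleTo⇒∈W {a = a} U-sub W⊆U supported⇒W (w , Ww , a≈w) Ua =
      ≋-closed W-sub (λ v → x-y+y≈x (a v) (w v))
        (+-closed W-sub (supported⇒W (-ᵛ-closed U-sub Ua (W⊆U Ww)) (λ v v∉S → x≈y⇒x-y≈0 (a≈w v v∉S))) Ww)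


module StarStresses (ℝ : RealField) {n : ℕ} (Δ : SimplicialComplex n) where
  open import Data.Nat using (_+_)
  open RealField ℝ using (Carrier; _≈_; 1#; 0#) renaming (refl to ≈-refl; sym to ≈-sym; trans to ≈-trans)
  open Lin ℝ
  open LinearAlgebra ℝ
  open SimplicialComplex Δ using (down-closed; vertices)

  InStarOf : Subset n → Fin n → Set
  InStarOf G v = InStar Δ G ⁅ v ⁆

  _⊆Star_ : Subset n → Subset n → Set
  S ⊆Star G = ∀ {v} → v ∈ S → InStarOf G v

  StarStress : ∀ {d} → (Fin n → Fin d → Carrier) → Subset n → Vector Carrier n → Set
  StarStress p G = IsStress1 (InStar Δ G) p

  star-antitone : ∀ {G H σ} → H ⊆ G → InStar Δ G σ → InStar Δ H σ
  star-antitone {G} {H} {σ} H⊆G = down-closed (p⊆r∧q⊆r⇒p∪q⊆r (p⊆p∪q G) (q⊆p∪q σ G ∘ H⊆G))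

  starSpan⇒stress : ∀ {d} (p : Fin n → Fin d → Carrier) {I : Subset n → Set} {a} →
                    InSumOfSubspaces I (StarStress p) a → IsStress1 (IsFace Δ) p a
  starSpan⇒stress p a∈span =
    (λ v ¬vertex → contradiction (vertices v) ¬vertex) ,
    inSum-least (affineDependence-isSubspace p) (λ _ → proj₂) a∈span

  starSpan⇒vertexStarSpan : ∀ {d} (p : Fin n → Fin d → Carrier) m {a} →
    InSumOfSubspaces (λ G → IsFace Δ G × ∣ G ∣ ≡ suc m) (StarStress p) a →
    InSumOfSubspaces (λ G → IsFace Δ G × ∣ G ∣ ≡ 1) (StarStress p) a
  starSpan⇒vertexStarSpan p m =
    inSum-least (inSum-isSubspace (λ G → stress-isSubspace (InStar Δ G) p)) λ (_ , ∣G∣≡1+m) (G-supp , dep) →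
      let g , g∈G = 0<∣p∣⇒Nonempty (ℕ.≤-trans (s≤s z≤n) (ℕ.≤-reflexive (≡-sym ∣G∣≡1+m))) in
      ∈⇒inSum (vertices g , ∣⁅x⁆∣≡1 g) (supportedIn-mono (star-antitone (x∈p⇒⁅x⁆⊆p g∈G)) G-supp , dep)

  module Codimension2 (k : ℕ) (p : Fin n → Fin (2 + k) → Carrier) where

    IsCodim2Face : Subset n → Set
    IsCodim2Face G = IsFace Δ G × ∣ G ∣ ≡ k

    InStarSpan : Vector Carrier n → Set
    InStarSpan = InSumOfSubspaces IsCodim2Face (StarStress p)

    starSpan-isSubspace : IsSubspace InStarSpan
    starSpan-isSubspace = inSum-isSubspace (λ G → stress-isSubspace (InStar Δ G) p)

    open Reduction starSpan-isSubspace

    δ-reducibleTo-in-star : ∀ {G S} x → IsCodim2Face G → S ⊆Star G → InStarOf G x →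
                            AffinelyIndependentOn p S → ∣ S ∣ ≡ 3 + k → ReducibleTo S (δ x)
    δ-reducibleTo-in-star {G} {S} x G-face S⊆st x∈st S-indep ∣S∣≡3+k with x ∈? S
    ... | yes x∈S = ∈⇒δ-reducibleTo x∈S
    ... | no  x∉S with ∃-affineDependence-normalisedAt p S-indep ∣S∣≡3+k x∉S
    ...   | c , c-dep , c-supp , cx≈1 =
      c , ∈⇒inSum G-face (supportedIn-mono S∪x⊆st c-supp , c-dep) , δx≈c
      where
      S∪x⊆st : (S ∪ ⁅ x ⁆) ⊆Star G
      S∪x⊆st {v} v∈S∪x = [ S⊆st , (λ v∈⁅x⁆ → subst (InStarOf G) (≡-sym (x∈⁅y⁆⇒x≡y x v∈⁅x⁆)) x∈st) ]′
                           (x∈p∪q⁻ S ⁅ x ⁆ v∈S∪x)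
      δx≈c : ∀ v → v ∉ S → δ x v ≈ c v
      δx≈c v v∉S with x Fin.≟ v
      ... | yes refl = ≈-trans (δ-diag x) (≈-sym cx≈1)
      ... | no  x≢v  = ≈-trans (δ-off (≢-sym x≢v)) (≈-sym (c-supp v (x∉p∧x≢y⇒x∉p∪⁅y⁆ v∉S (≢-sym x≢v))))

    reducibleTo-transfer : ∀ {G S T} {a : Vector Carrier n} → IsCodim2Face G →
                           S ⊆Star G → T ⊆Star G →
                           AffinelyIndependentOn p S → ∣ S ∣ ≡ 3 + k → ReducibleTo T a → ReducibleTo S a
    reducibleTo-transfer G-face S⊆st T⊆st S-indep ∣S∣≡3+k a-reducible =
      reducibleTo-trans a-reducible λ y y∈T → δ-reducibleTo-in-star y G-face S⊆st (T⊆st y∈T) S-indep ∣S∣≡3+k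

    Facet₂₊ₖ : Set
    Facet₂₊ₖ = Facet Δ (2 + k)

    Adj : Facet₂₊ₖ → Facet₂₊ₖ → Set
    Adj = Adjacent Δ (2 + k)

    facet⊆star : ∀ {G} (F : Facet₂₊ₖ) → G ⊆ proj₁ F → proj₁ F ⊆Star G
    facet⊆star (F , F-face , _) G⊆F v∈F = down-closed (p⊆r∧q⊆r⇒p∪q⊆r (x∈p⇒⁅x⁆⊆p v∈F) G⊆F) F-face

    facets⊆star : ∀ {G} (A B : Facet₂₊ₖ) → G ⊆ proj₁ A → G ⊆ proj₁ B → (proj₁ A ∪ proj₁ B) ⊆Star G
    facets⊆star A B G⊆A G⊆B v∈A∪B = [ facet⊆star A G⊆A , facet⊆star B G⊆B ]′ (x∈p∪q⁻ (proj₁ A) (proj₁ B) v∈A∪B)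

    adjacent-sym : ∀ {A B} → Adj A B → Adj B A
    adjacent-sym {A , _} {B , _} ∣A∩B∣ = ≡-trans (cong ∣_∣ (∩-comm B A)) ∣A∩B∣

    ∣A∪B∣≡3+k : ∀ {A B} → Adj A B → ∣ proj₁ A ∪ proj₁ B ∣ ≡ 3 + k
    ∣A∪B∣≡3+k {A , _ , ∣A∣} {B , _ , ∣B∣} ∣A∩B∣ = ∣p∪q∣≡3+k A B ∣A∣ ∣B∣ ∣A∩B∣

    module _ (indep : ∀ A B → Adj A B → AffinelyIndependentOn p (proj₁ A ∪ proj₁ B)) where

      δ-reducibleTo-along-path : (A B C : Facet₂₊ₖ) → Adj A B → Star Adj B C →
                                 ∀ {x} → x ∈ proj₁ C → ReducibleTo (proj₁ A ∪ proj₁ B) (δ x)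
      δ-reducibleTo-along-path A B .B A~B ε x∈B = ∈⇒δ-reducibleTo (x∈p∪q⁺ (inj₂ x∈B))
      δ-reducibleTo-along-path A@(A₀ , _) B@(B₀ , B-face , ∣B∣) C A~B (_◅_ {j = B′} B~B′ B′⇝C) x∈C =
        let G , G⊆B , G⊆A , G⊆B′ , ∣G∣≡k = ∃-⊆-common-of-size B₀ A₀ (proj₁ B′) ∣B∣ (adjacent-sym {A} {B} A~B) B~B′
        in  reducibleTo-transfer (down-closed G⊆B B-face , ∣G∣≡k)
              (facets⊆star A B G⊆A G⊆B) (facets⊆star B B′ G⊆B G⊆B′) (indep A B A~B) (∣A∪B∣≡3+k {A} {B} A~B)
              (δ-reducibleTo-along-path B B′ C B~B′ B′⇝C x∈C)

      ReducingStar : Subset n → Set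
      ReducingStar S = ∃ λ G → IsCodim2Face G × S ⊆Star G × (∀ x → ReducibleTo S (δ x))

      module _ (pure : IsPure Δ (2 + k)) (strongly-connected : StronglyConnected Δ (2 + k)) where

        facetThrough : (v : Fin n) → ∃ λ (F : Facet₂₊ₖ) → v ∈ proj₁ F
        facetThrough v with proj₁ pure ⁅ v ⁆ (vertices v)
        ... | F , F-face , ⁅v⁆⊆F , ∣F∣ = (F , F-face , ∣F∣) , ⁅v⁆⊆F (x∈⁅x⁆ v)

        ∃-adjacent : ∀ {F C : Facet₂₊ₖ} {x} → Star Adj F C → x ∈ proj₁ C → x ∉ proj₁ F → ∃ (Adj F)
        ∃-adjacent ε                   x∈F x∉F = contradiction x∈F x∉F
        ∃-adjacent (_◅_ {j = B} F~B _) _   _   = B , F~B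

        facet-reducingStar : (F : Facet₂₊ₖ) → (∀ x → x ∈ proj₁ F) → ReducingStar (proj₁ F)
        facet-reducingStar F@(F₀ , F-face , ∣F∣) all∈F =
          let G , G⊆F , ∣G∣≡k = ∃-⊆-of-size k F₀ (ℕ.≤-trans (ℕ.m≤n+m k 2) (ℕ.≤-reflexive (≡-sym ∣F∣)))
          in  G , (down-closed G⊆F F-face , ∣G∣≡k) , facet⊆star F G⊆F , λ x → ∈⇒δ-reducibleTo (all∈F x)

        adjacent-reducingStar : ∀ F B → Adj F B → ReducingStar (proj₁ B ∪ proj₁ F)
        adjacent-reducingStar F@(F₀ , F-face , _) B@(B₀ , _) F~B =
          let G , G⊆B∩F , ∣G∣≡k = ∃-⊆-of-size k (B₀ ∩ F₀) (ℕ.≤-trans (ℕ.n≤1+n k) (ℕ.≤-reflexive (≡-sym B~F)))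
          in  G , (down-closed (p∩q⊆q B₀ F₀ ∘ G⊆B∩F) F-face , ∣G∣≡k) ,
              facets⊆star B F (p∩q⊆p B₀ F₀ ∘ G⊆B∩F) (p∩q⊆q B₀ F₀ ∘ G⊆B∩F) ,
              λ x → let Fₓ , x∈Fₓ = facetThrough x
                    in  δ-reducibleTo-along-path B F Fₓ B~F (strongly-connected F Fₓ) x∈Fₓ
          where
          B~F : Adj B F
          B~F = adjacent-sym {F} {B} F~B

        ∃-reducingStar : Facet₂₊ₖ → ∃ ReducingStar
        ∃-reducingStar F with Fin.all? (_∈? proj₁ F)
        ... | yes all∈F = proj₁ F , facet-reducingStar F all∈F
        ... | no  ¬all∈F =
          let u , u∉F = Fin.¬∀⟶∃¬ n (_∈ proj₁ F) (_∈? proj₁ F) ¬all∈F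
              Fᵤ , u∈Fᵤ = facetThrough u
              B , F~B = ∃-adjacent (strongly-connected F Fᵤ) u∈Fᵤ u∉F
          in  proj₁ B ∪ proj₁ F , adjacent-reducingStar F B F~B

        affineDependence⇒∈starSpan : ∀ {a} → AffineDependence p a → InStarSpan a
        affineDependence⇒∈starSpan a-dep with Fin.any? {P = λ _ → ⊤} (λ _ → yes tt)
        ... | no  no-vertex =
          ≋-closed starSpan-isSubspace (λ v → contradiction (v , tt) no-vertex) (0ᵛ-closed starSpan-isSubspace)
        ... | yes (v , _) =
          let S , G , G-face , S⊆st , δ-reducible = ∃-reducingStar (proj₁ (facetThrough v))
          in  reducibleTo⇒∈W (affineDependence-isSubspace p)
                (inSum-least (affineDependence-isSubspace p) (λ _ → proj₂))
                (λ b-dep b-supp → ∈⇒inSum G-face (supportedIn-mono S⊆st b-supp , b-dep))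
                (spanned-by-δ (reducibleTo-isSubspace S) (inj₂ ∘ δ-reducible)) a-dep

theorem4p1 : (ℝ : RealField) →
    (d : ℕ) → 3 ≤ d → (n : ℕ) → (Δ : SimplicialComplex n) →
    IsPure Δ d → StronglyConnected Δ d →
    (p : Fin n → Fin d → RealField.Carrier ℝ) →
    (∀ (F F' : Facet Δ d) → Adjacent Δ d F F' →
       Lin.AffinelyIndependentOn ℝ p (proj₁ F ∪ proj₁ F')) →
    ∀ (a : Fin n → RealField.Carrier ℝ) →
      ((Lin.IsStress1 ℝ (IsFace Δ) p a →
          Lin.InSumOfSubspaces ℝ (λ G → IsFace Δ G × ∣ G ∣ ≡ d ∸ 2)
                           (λ G → Lin.IsStress1 ℝ (InStar Δ G) p) a)
       × (Lin.InSumOfSubspaces ℝ (λ G → IsFace Δ G × ∣ G ∣ ≡ d ∸ 2)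
                           (λ G → Lin.IsStress1 ℝ (InStar Δ G) p) a →
          Lin.IsStress1 ℝ (IsFace Δ) p a))
      × ((Lin.IsStress1 ℝ (IsFace Δ) p a →
          Lin.InSumOfSubspaces ℝ (λ G → IsFace Δ G × ∣ G ∣ ≡ 1)
                           (λ G → Lin.IsStress1 ℝ (InStar Δ G) p) a)
       × (Lin.InSumOfSubspaces ℝ (λ G → IsFace Δ G × ∣ G ∣ ≡ 1)
                           (λ G → Lin.IsStress1 ℝ (InStar Δ G) p) a →
          Lin.IsStress1 ℝ (IsFace Δ) p a))
theorem4p1 ℝ (suc (suc (suc k))) (s≤s (s≤s (s≤s z≤n))) n Δ pure strongly-connected p indep a =
  (stress⇒starSpan , starSpan⇒stress p) , (starSpan⇒vertexStarSpan p k ∘ stress⇒starSpan , starSpan⇒stress p)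
  where
  open StarStresses ℝ Δ
  open Codimension2 (suc k) p
  stress⇒starSpan : Lin.IsStress1 ℝ (IsFace Δ) p a → InStarSpan a
  stress⇒starSpan (_ , a-dep) = affineDependence⇒∈starSpan indep pure strongly-connected a-dep
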